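{- For every $k\ge1$, $\mathcal{R}_{U_k}(W_2)\subseteq\mathcal{R}(W_2)$.
   Context: The 2-way tape $W_2$ is the memory model with cells $0,1,2,\dots$, initial cell $0$, and from each cell $n$ an edge $n\to n+1$ marked $+$ and an edge $n\to n-1$ marked $-$ (at cell $0$ the $-$ edge is taken to be a loop). An $h$-head automaton with auxiliary memory of model $M$ has a finite state set, input alphabet with endmarkers, a finite memory alphabet $\Delta$, a transition function mapping (state, the $h$ symbols under its 2-way read-only input heads, the current memory symbol) to (new state, a move in $\{ -1,0,+1\}$ per head, and a mark to follow in the memory graph or "stay"), an initial state and accepting states; it starts with heads at the leftmost input symbol and memory at the initial cell and runs deterministically for a fixed memory content $\mu\colon M\to\Delta$. It accepts $w$ iff it reaches an accepting state for some $\mu$; $\mathcal{R}(M)$ is the class of languages so recognized. For $\mathcal{T}\subseteq\Delta^M$, acceptance with a $\mathcal{T}$-restricted guess means reaching an accepting state on some $\mu\in\mathcal{T}$; $\mathcal{R}_{\mathcal{T}}(M)$ is the corresponding class. For $\Delta=\{0\}\cup\Delta'$, $U_k$ is the set of memory contents with at most $k$ cells containing symbols from $\Delta'$. -}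

module Defs where

open import Data.Nat using (ℕ; zero; suc; pred; _⊔_; _⊓_; _+_)
open import Data.Fin using (Fin)
open import Data.Bool using (Bool; true)
open import Data.List using (List; length; lookup)
open import Data.Vec using (Vec; zipWith; map)
open import Data.Product using (Σ; _×_; _,_; proj₁; proj₂; ∃; ∃-syntax)
open import Relation.Binary.PropositionalEquality using (_≡_; _≢_)
open import Data.Vec.Membership.Propositional using (_∈_)
open import Function.Bundles using (_⇔_)

-- Input tape: the word w of length n surrounded by endmarkers.
-- Position 0 holds the left endmarker ⊢, positions 1..n the letters,
-- position n+1 the right endmarker ⊣.

data TapeSym (s : ℕ) : Set where
  ⊢  : TapeSym s
  ⊣  : TapeSym s
  sym : Fin s → TapeSym s

readInput : {s : ℕ} → List (Fin s) → ℕ → TapeSym s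
readInput w zero = ⊢
readInput w (suc p) = go w p
  where
  go : List (Fin _) → ℕ → TapeSym _
  go Data.List.[] _ = ⊣
  go (a Data.List.∷ _) zero = sym a
  go (_ Data.List.∷ as) (suc q) = go as q

data HeadMove : Set where
  left stay right : HeadMove

-- Heads never leave the segment [0, n+1] (moves beyond an endmarker are
-- blocked, i.e. the head stays).
moveHead : ℕ → HeadMove → ℕ → ℕ
moveHead n left  p = pred p
moveHead n stay  p = p
moveHead n right p = suc p ⊓ suc n

-- The memory model W₂ (2-way tape): cells ℕ, initial cell 0,
-- edge n → n+1 marked +, edge n → n-1 marked − (a loop at cell 0).

data W₂Mark : Set where
  plus minus : W₂Mark

data MemMove : Set where
  follow : W₂Mark → MemMove
  stayM  : MemMove

moveMem : MemMove → ℕ → ℕ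
moveMem (follow plus)  c = suc c
moveMem (follow minus) c = pred c
moveMem stayM          c = c

record Automaton (s d : ℕ) : Set where
  field
    h q       : ℕ
    δ         : Fin q → Vec (TapeSym s) h → Fin d →
                Fin q × Vec HeadMove h × MemMove
    q₀        : Fin q
    accepting : Fin q → Bool

module _ {s d : ℕ} (A : Automaton s d) where
  open Automaton A

  record Config : Set where
    constructor conf
    field
      state : Fin q
      heads : Vec ℕ h
      cell  : ℕ

  initConf : Config
  initConf = conf q₀ (Data.Vec.replicate h 1) 0

  step : List (Fin s) → (ℕ → Fin d) → Config → Config
  step w μ (conf st hs c) with δ st (map (readInput w) hs) (μ c)
  ... | st' , mv , mm = conf st' (zipWith (λ m p → moveHead (length w) m p) mv hs) (moveMem mm c)

  run : List (Fin s) → (ℕ → Fin d) → ℕ → Config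
  run w μ zero    = initConf
  run w μ (suc t) = step w μ (run w μ t)

  AcceptsWith : List (Fin s) → (ℕ → Fin d) → Set
  AcceptsWith w μ = ∃[ t ] accepting (Config.state (run w μ t)) ≡ true

  AcceptsRestr : (𝒯 : (ℕ → Fin d) → Set) → List (Fin s) → Set
  AcceptsRestr 𝒯 w = ∃[ μ ] (𝒯 μ × AcceptsWith w μ)

  Accepts : List (Fin s) → Set
  Accepts w = ∃[ μ ] AcceptsWith w μ

Language : ℕ → Set₁
Language s = List (Fin s) → Set

InR : {s : ℕ} → Language s → Set
InR {s} L = Σ ℕ λ d → Σ (Automaton s d) λ A → (∀ w → L w ⇔ Accepts A w)

-- U_k: memory alphabet Δ = {0} ∪ Δ' with 0 the distinguished symbol
-- (modelled as Fin d with d ≥ 1 and 0 = Fin.zero); contents with at most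
-- k cells holding a symbol different from 0.

U : (k : ℕ) {d : ℕ} → (ℕ → Fin (suc d)) → Set
U k μ = Σ (Vec ℕ k) λ cells → ∀ n → μ n ≢ Fin.zero → n ∈ cells

InRU : (k : ℕ) {s : ℕ} → Language s → Set
InRU k {s} L =
  Σ ℕ λ d' → Σ (Automaton s (suc d')) λ A → (∀ w → L w ⇔ AcceptsRestr A (U k) w)

-- Given A accepting with U_k-restricted guesses, we build a checker that
-- accepts with arbitrary guesses.  Its guessed memory marks cell 0 as the
-- origin, cells 1..E-1 as plain and cell E as the end of a region; every cell
-- also carries a symbol of A.  The checker first sweeps the region from left
-- to right counting nonzero symbols (rejecting when the count exceeds k),
-- walks back to the origin, and then simulates A on the region's symbols
-- (blank outside), rejecting if A ever reaches the end cell.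

module Submission where

open import Defs hiding (sym)
open import Data.Nat using (ℕ; zero; suc; pred; _+_; _≤_; _<_; _≥_; z≤n; s≤s; _<?_; _≟_; >-nonZero)
open import Data.Nat.Properties
open import Data.Fin as Fin using (Fin; toℕ; fromℕ<)
open import Data.Fin.Properties using (splitAt-join; toℕ-fromℕ<; toℕ<n) renaming (0≢1+n to zero≢suc)
open import Data.Bool using (Bool; true; false)
open import Data.List using (List; length; filter)
open import Data.List.Properties using (filter-notAll)
open import Data.List.Membership.Propositional using () renaming (_∈_ to _∈ₗ_)
open import Data.List.Membership.Propositional.Properties using (∈-filter⁺)
open import Data.List.Relation.Unary.Any as Any using ()
open import Data.Vec using (Vec; _∷_; replicate; zipWith; map; toList)
open import Data.Vec.Properties using (zipWith-replicate; length-toList)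
open import Data.Vec.Relation.Unary.Any using (here; there)
open import Data.Vec.Membership.Propositional using (_∈_)
open import Data.Vec.Membership.Propositional.Properties using (∈-toList⁺)
open import Data.Product using (Σ; _×_; _,_; proj₁; proj₂; ∃-syntax; map₁)
open import Data.Sum as Sum using (_⊎_; inj₁; inj₂)
open import Data.Unit using (⊤; tt)
open import Data.Empty using (⊥-elim)
open import Function using (_∘_)
open import Function.Bundles using (_⇔_; mk⇔)
open import Function.Properties.Equivalence using () renaming (trans to ⇔-trans; sym to ⇔-sym)
open import Relation.Nullary using (yes; no; ¬?)
open import Relation.Binary.PropositionalEquality

record Finite (X : Set) : Set where
  field
    size          : ℕ
    encode        : X → Fin size
    decode        : Fin size → X
    decode-encode : ∀ x → decode (encode x) ≡ x

finite-Fin : ∀ n → Finite (Fin n)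
finite-Fin n = record
  { size = n ; encode = λ i → i ; decode = λ i → i ; decode-encode = λ _ → refl }

finite-⊤ : Finite ⊤
finite-⊤ = record
  { size = 1 ; encode = λ _ → Fin.zero ; decode = λ _ → tt ; decode-encode = λ _ → refl }

finite-⊎ : ∀ {X Y} → Finite X → Finite Y → Finite (X ⊎ Y)
finite-⊎ FX FY = record
  { size          = X.size + Y.size
  ; encode        = Fin.join X.size Y.size ∘ Sum.map X.encode Y.encode
  ; decode        = Sum.map X.decode Y.decode ∘ Fin.splitAt X.size
  ; decode-encode = λ x → trans
      (cong (Sum.map X.decode Y.decode) (splitAt-join X.size Y.size (Sum.map X.encode Y.encode x)))
      (decode-encode-⊎ x)
  }
  where
  module X = Finite FX
  module Y = Finite FY
  decode-encode-⊎ : ∀ x → Sum.map X.decode Y.decode (Sum.map X.encode Y.encode x) ≡ x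
  decode-encode-⊎ (inj₁ x) = cong inj₁ (X.decode-encode x)
  decode-encode-⊎ (inj₂ y) = cong inj₂ (Y.decode-encode y)

finite-retract : ∀ {X Y} (f : X → Y) (g : Y → X) → (∀ x → g (f x) ≡ x) →
                 Finite Y → Finite X
finite-retract f g gf FY = record
  { size = size ; encode = encode ∘ f ; decode = g ∘ decode
  ; decode-encode = λ x → trans (cong g (decode-encode (f x))) (gf x) }
  where open Finite FY

-- Machines: automata with W₂ memory whose state and memory-symbol sets are
-- arbitrary types.  Finite ones are realised as automata in the sense of Defs.

record Machine (s h : ℕ) : Set₁ where
  field
    State Symbol : Set
    δ     : State → Vec (TapeSym s) h → Symbol → State × Vec HeadMove h × MemMove
    start : State
    final : State → Bool

module Run {s h : ℕ} (M : Machine s h) where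
  open Machine M

  record MConfig : Set where
    constructor ⟨_,_,_⟩
    field
      state : State
      heads : Vec ℕ h
      cell  : ℕ

  move : List (Fin s) → Symbol → MConfig → MConfig
  move w x ⟨ p , hs , c ⟩ with δ p (map (readInput w) hs) x
  ... | p' , mv , mm = ⟨ p' , zipWith (moveHead (length w)) mv hs , moveMem mm c ⟩

  steps : List (Fin s) → (ℕ → Symbol) → ℕ → MConfig → MConfig
  steps w m zero    C = C
  steps w m (suc t) C = let C' = steps w m t C in move w (m (MConfig.cell C')) C'

  initial : MConfig
  initial = ⟨ start , replicate h 1 , 0 ⟩

  MAccepts : List (Fin s) → Set
  MAccepts w = ∃[ m ] ∃[ t ] final (MConfig.state (steps w m t initial)) ≡ true

  Reaches : List (Fin s) → (ℕ → Symbol) → MConfig → MConfig → Set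
  Reaches w m C C' = ∃[ t ] steps w m t C ≡ C'

  steps-+ : ∀ w m i j C → steps w m (i + j) C ≡ steps w m i (steps w m j C)
  steps-+ w m zero    j C = refl
  steps-+ w m (suc i) j C =
    cong (λ C' → move w (m (MConfig.cell C')) C') (steps-+ w m i j C)

  reaches-step : ∀ {w m C C'} → move w (m (MConfig.cell C)) C ≡ C' → Reaches w m C C'
  reaches-step eq = 1 , eq

  reaches-trans : ∀ {w m C C' C''} → Reaches w m C C' → Reaches w m C' C'' →
                  Reaches w m C C''
  reaches-trans {w} {m} {C} (i , refl) (j , refl) = j + i , steps-+ w m j i C

  steps-cong : ∀ w {m m'} → (∀ n → m n ≡ m' n) → ∀ t C → steps w m t C ≡ steps w m' t C
  steps-cong w m≗m' zero    C = refl
  steps-cong w {m} {m'} m≗m' (suc t) C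
    rewrite steps-cong w m≗m' t C = cong (λ x → move w x _) (m≗m' _)

module Realise {s h : ℕ} (M : Machine s h)
               (FS : Finite (Machine.State M)) (FΣ : Finite (Machine.Symbol M)) where
  open Machine M
  open Run M
  module States  = Finite FS
  module Symbols = Finite FΣ

  automaton : Automaton s Symbols.size
  automaton = record
    { h = h ; q = States.size
    ; δ = λ x rs a → map₁ States.encode (δ (States.decode x) rs (Symbols.decode a))
    ; q₀ = States.encode start
    ; accepting = final ∘ States.decode
    }

  encodeConfig : MConfig → Config automaton
  encodeConfig ⟨ p , hs , c ⟩ = conf (States.encode p) hs c

  run-encoded : ∀ w ν t →
                run automaton w ν t ≡ encodeConfig (steps w (Symbols.decode ∘ ν) t initial)
  run-encoded w ν zero    = refl
  run-encoded w ν (suc t) rewrite run-encoded w ν t = step-encoded _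
    where
    step-encoded : ∀ C → step automaton w ν (encodeConfig C)
                         ≡ encodeConfig (move w (Symbols.decode (ν (MConfig.cell C))) C)
    step-encoded ⟨ p , hs , c ⟩ rewrite States.decode-encode p = refl

  accepted : Config automaton → Bool
  accepted = Automaton.accepting automaton ∘ Config.state

  accepted-run : ∀ w ν t →
                 accepted (run automaton w ν t)
                 ≡ final (MConfig.state (steps w (Symbols.decode ∘ ν) t initial))
  accepted-run w ν t rewrite run-encoded w ν t =
    accepted-encoded (steps w (Symbols.decode ∘ ν) t initial)
    where
    accepted-encoded : ∀ C → accepted (encodeConfig C) ≡ final (MConfig.state C)
    accepted-encoded ⟨ p , _ , _ ⟩ = cong final (States.decode-encode p)

  accepts⇔ : ∀ w → Accepts automaton w ⇔ MAccepts w
  accepts⇔ w = mk⇔ to from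
    where
    to : Accepts automaton w → MAccepts w
    to (ν , t , acc) = Symbols.decode ∘ ν , t , trans (sym (accepted-run w ν t)) acc
    from : MAccepts w → Accepts automaton w
    from (m , t , acc) = Symbols.encode ∘ m , t , trans (accepted-run w _ t) (trans decoded acc)
      where
      decoded : final (MConfig.state (steps w (Symbols.decode ∘ Symbols.encode ∘ m) t initial))
                ≡ final (MConfig.state (steps w m t initial))
      decoded = cong (final ∘ MConfig.state) (steps-cong w (Symbols.decode-encode ∘ m) t initial)

nz : ∀ {d} → Fin (suc d) → ℕ
nz Fin.zero    = 0
nz (Fin.suc _) = 1

nonzeros : ∀ {d} → (ℕ → Fin (suc d)) → ℕ → ℕ
nonzeros f zero    = 0
nonzeros f (suc n) = nonzeros f n + nz (f n)

nonzeros-cong : ∀ {d} {f g : ℕ → Fin (suc d)} n → (∀ i → i < n → f i ≡ g i) →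
                nonzeros f n ≡ nonzeros g n
nonzeros-cong zero    f≗g = refl
nonzeros-cong (suc n) f≗g =
  cong₂ _+_ (nonzeros-cong n (λ i i<n → f≗g i (m≤n⇒m≤1+n i<n))) (cong nz (f≗g n ≤-refl))

nonzeros-mono : ∀ {d} (f : ℕ → Fin (suc d)) {m n} → m ≤ n → nonzeros f m ≤ nonzeros f n
nonzeros-mono f {n = zero}  z≤n = z≤n
nonzeros-mono f {m} {suc n} m≤1+n with m≤n⇒m<n∨m≡n m≤1+n
... | inj₁ m<1+n = ≤-trans (nonzeros-mono f (≤-pred m<1+n)) (m≤m+n _ _)
... | inj₂ refl  = ≤-refl

-- If all nonzero cells below n occur in xs, there are at most |xs| of them.
-- Each nonzero cell is removed from xs before counting the cells below it.
nonzeros-≤-cover : ∀ {d} (f : ℕ → Fin (suc d)) n (xs : List ℕ) →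
                   (∀ i → i < n → f i ≢ Fin.zero → i ∈ₗ xs) → nonzeros f n ≤ length xs
nonzeros-≤-cover f zero    xs covers = z≤n
nonzeros-≤-cover f (suc n) xs covers with f n in fn≡
... | Fin.zero  = ≤-trans (≤-reflexive (+-identityʳ _))
                    (nonzeros-≤-cover f n xs (λ i i<n → covers i (m≤n⇒m≤1+n i<n)))
... | Fin.suc _ = ≤-trans (≤-reflexive (+-comm _ 1)) (<-≤-trans (s≤s counted) shorter)
  where
  others : List ℕ
  others = filter (λ i → ¬? (i ≟ n)) xs
  n∈xs : n ∈ₗ xs
  n∈xs = covers n ≤-refl (λ fn≡0 → zero≢suc (trans (sym fn≡0) fn≡))
  shorter : length others < length xs
  shorter = filter-notAll _ xs (Any.map (λ i≡n i≢n → i≢n (sym i≡n)) n∈xs)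
  counted : nonzeros f n ≤ length others
  counted = nonzeros-≤-cover f n others
    (λ i i<n nz-i → ∈-filter⁺ _ (covers i (m≤n⇒m≤1+n i<n) nz-i) (<⇒≢ i<n))

Covers : ∀ {d k} → (ℕ → Fin (suc d)) → ℕ → Vec ℕ k → Set
Covers f E v = ∀ i → i < E → f i ≢ Fin.zero → i ∈ v

cover-step : ∀ {d k} {f : ℕ → Fin (suc d)} {E} {v : Vec ℕ k} →
             Covers f E v → (f E ≢ Fin.zero → E ∈ v) → Covers f (suc E) v
cover-step covers covers-E i i<1+E nz-i with m<1+n⇒m<n∨m≡n i<1+E
... | inj₁ i<E  = covers i i<E nz-i
... | inj₂ refl = covers-E nz-i

cover-of-nonzeros : ∀ {d} (f : ℕ → Fin (suc d)) E k → nonzeros f E ≤ k →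
                    Σ (Vec ℕ k) (Covers f E)
cover-of-nonzeros f zero    k _ = replicate k 0 , λ i ()
cover-of-nonzeros f (suc E) k bound with f E in fE≡
... | Fin.zero =
  let v , covers = cover-of-nonzeros f E k (≤-trans (≤-reflexive (sym (+-identityʳ _))) bound)
  in v , cover-step covers (λ nz-E → ⊥-elim (nz-E fE≡))
... | Fin.suc _ with k | ≤-trans (≤-reflexive (+-comm 1 _)) bound
...   | suc k′ | s≤s bound′ =
  let v , covers = cover-of-nonzeros f E k′ bound′
  in E ∷ v , cover-step (λ i i<E nz-i → there (covers i i<E nz-i)) (λ _ → here refl)

cell-step-≤ : ∀ {s d} (A : Automaton s d) w μ (C : Config A) →
              Config.cell (step A w μ C) ≤ suc (Config.cell C)
cell-step-≤ A w μ (conf p hs c) =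
  moveMem-≤ (proj₂ (proj₂ (Automaton.δ A p (map (readInput w) hs) (μ c)))) c
  where
  moveMem-≤ : ∀ mm c → moveMem mm c ≤ suc c
  moveMem-≤ (follow plus)  c = ≤-refl
  moveMem-≤ (follow minus) c = m≤n⇒m≤1+n pred[n]≤n
  moveMem-≤ stayM          c = n≤1+n c

cell-run-≤ : ∀ {s d} (A : Automaton s d) w μ t → Config.cell (run A w μ t) ≤ t
cell-run-≤ A w μ zero    = z≤n
cell-run-≤ A w μ (suc t) = ≤-trans (cell-step-≤ A w μ (run A w μ t)) (s≤s (cell-run-≤ A w μ t))

module Checker {s d : ℕ} (k : ℕ) (A : Automaton s (suc d)) where
  open Automaton A renaming (q to stateCount)

  data Phase : Set where
    start    : Phase
    scan     : Fin (suc k) → Phase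
    return   : Phase
    simulate : Fin stateCount → Phase
    reject   : Phase

  data Cell : Set where
    origin plain : Fin (suc d) → Cell
    end          : Cell

  symbolOf : Cell → Fin (suc d)
  symbolOf (origin a) = a
  symbolOf (plain a)  = a
  symbolOf end        = Fin.zero

  tally : ℕ → Phase
  tally n with n <? suc k
  ... | yes n<1+k = scan (fromℕ< n<1+k)
  ... | no _      = reject

  data TallyView (n : ℕ) : Phase → Set where
    counted  : (j : Fin (suc k)) → toℕ j ≡ n → TallyView n (scan j)
    overflow : k < n → TallyView n reject

  tally-view : ∀ n → TallyView n (tally n)
  tally-view n with n <? suc k
  ... | yes n<1+k = counted (fromℕ< n<1+k) (toℕ-fromℕ< n<1+k)
  ... | no n≮1+k  = overflow (≰⇒> (n≮1+k ∘ s≤s))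

  tally-≤ : ∀ n → n ≤ k → Σ (Fin (suc k)) λ j → tally n ≡ scan j × toℕ j ≡ n
  tally-≤ n n≤k with tally n | tally-view n
  ... | _ | counted j j≡n = j , refl , j≡n
  ... | _ | overflow k<n  = ⊥-elim (<⇒≱ k<n n≤k)

  stays : Vec HeadMove h
  stays = replicate h stay

  transition : Phase → Vec (TapeSym s) h → Cell → Phase × Vec HeadMove h × MemMove
  transition start        _  (origin a) = tally (nz a) , stays , follow plus
  transition (scan j)     _  (plain a)  = tally (toℕ j + nz a) , stays , follow plus
  transition (scan j)     _  end        = return , stays , follow minus
  transition return       _  (plain a)  = return , stays , follow minus
  transition return       _  (origin a) = simulate q₀ , stays , stayM
  transition (simulate p) rs (origin a) = map₁ simulate (δ p rs a)
  transition (simulate p) rs (plain a)  = map₁ simulate (δ p rs a)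
  transition _            _  _          = reject , stays , stayM

  isFinal : Phase → Bool
  isFinal (simulate p) = accepting p
  isFinal _            = false

  checker : Machine s h
  checker = record
    { State = Phase ; Symbol = Cell ; δ = transition ; start = start ; final = isFinal }

  finite-Phase : Finite Phase
  finite-Phase = finite-retract to from from-to
    (finite-⊎ finite-⊤ (finite-⊎ (finite-Fin (suc k)) (finite-⊎ finite-⊤
      (finite-⊎ (finite-Fin stateCount) finite-⊤))))
    where
    to : Phase → ⊤ ⊎ (Fin (suc k) ⊎ (⊤ ⊎ (Fin stateCount ⊎ ⊤)))
    to start        = inj₁ tt
    to (scan j)     = inj₂ (inj₁ j)
    to return       = inj₂ (inj₂ (inj₁ tt))
    to (simulate p) = inj₂ (inj₂ (inj₂ (inj₁ p)))
    to reject       = inj₂ (inj₂ (inj₂ (inj₂ tt)))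
    from : ⊤ ⊎ (Fin (suc k) ⊎ (⊤ ⊎ (Fin stateCount ⊎ ⊤))) → Phase
    from (inj₁ _)                      = start
    from (inj₂ (inj₁ j))               = scan j
    from (inj₂ (inj₂ (inj₁ _)))        = return
    from (inj₂ (inj₂ (inj₂ (inj₁ p)))) = simulate p
    from (inj₂ (inj₂ (inj₂ (inj₂ _)))) = reject
    from-to : ∀ p → from (to p) ≡ p
    from-to start        = refl
    from-to (scan j)     = refl
    from-to return       = refl
    from-to (simulate p) = refl
    from-to reject       = refl

  finite-Cell : Finite Cell
  finite-Cell = finite-retract to from from-to
    (finite-⊎ (finite-Fin (suc d)) (finite-⊎ (finite-Fin (suc d)) finite-⊤))
    where
    to : Cell → Fin (suc d) ⊎ (Fin (suc d) ⊎ ⊤)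
    to (origin a) = inj₁ a
    to (plain a)  = inj₂ (inj₁ a)
    to end        = inj₂ (inj₂ tt)
    from : Fin (suc d) ⊎ (Fin (suc d) ⊎ ⊤) → Cell
    from (inj₁ a)        = origin a
    from (inj₂ (inj₁ a)) = plain a
    from (inj₂ (inj₂ _)) = end
    from-to : ∀ x → from (to x) ≡ x
    from-to (origin a) = refl
    from-to (plain a)  = refl
    from-to end        = refl

  open Run checker

  home : Vec ℕ h
  home = replicate h 1

  home-stays : ∀ n → zipWith (moveHead n) stays home ≡ home
  home-stays n = zipWith-replicate (moveHead n) stay 1

  simulated : Config A → MConfig
  simulated (conf p hs c) = ⟨ simulate p , hs , c ⟩

  module Guess (w : List (Fin s)) (m : ℕ → Cell) where

    written : ℕ → Fin (suc d)
    written = symbolOf ∘ m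

    Prefix : ℕ → Set
    Prefix c = (∃[ a ] m 0 ≡ origin a) × (∀ i → 1 ≤ i → i < c → ∃[ a ] m i ≡ plain a)

    record Frame (E : ℕ) : Set where
      field
        prefix : Prefix E
        closed : m E ≡ end
        sparse : nonzeros written E ≤ k

    truncated : ℕ → ℕ → Fin (suc d)
    truncated E n with n <? E
    ... | yes _ = written n
    ... | no _  = Fin.zero

    truncated-below : ∀ {E n} → n < E → truncated E n ≡ written n
    truncated-below {E} {n} n<E with n <? E
    ... | yes _   = refl
    ... | no n≮E  = ⊥-elim (n≮E n<E)

    frame-in-U : ∀ {E} → Frame E → U k (truncated E)
    frame-in-U {E} F =
      let v , covers = cover-of-nonzeros written E k (Frame.sparse F)
      in v , truncated-covered covers
      where
      truncated-covered : ∀ {v : Vec ℕ k} → Covers written E v →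
                          ∀ n → truncated E n ≢ Fin.zero → n ∈ v
      truncated-covered covers n nz-n with n <? E
      ... | yes n<E = covers n n<E nz-n
      ... | no _    = ⊥-elim (nz-n refl)

    simulate-commutes : ∀ {μ} (C : Config A) x → x ≢ end → μ (Config.cell C) ≡ symbolOf x →
                        move w x (simulated C) ≡ simulated (step A w μ C)
    simulate-commutes (conf p hs c) (origin a) _ μc≡a rewrite μc≡a = refl
    simulate-commutes (conf p hs c) (plain a)  _ μc≡a rewrite μc≡a = refl
    simulate-commutes (conf p hs c) end        x≢end _ = ⊥-elim (x≢end refl)

    Stores : (ℕ → Fin (suc d)) → ℕ → Set
    Stores μ E = ∀ c → c < E → m c ≢ end × μ c ≡ written c

    count-step : ∀ {c x n} → m c ≡ x → n ≡ nonzeros written c →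
                 nonzeros written (suc c) ≡ n + nz (symbolOf x)
    count-step mc≡ n≡ = cong₂ _+_ (sym n≡) (cong (nz ∘ symbolOf) mc≡)

    -- Soundness: an invariant of all configurations reachable from the
    -- initial one; it records what the checker has verified about m so far:
    -- while scanning, the prefix and the count; while returning, a frame
    -- containing the current cell; while simulating, that A's run on the
    -- framed content reaches the simulated configuration.
    Inv : MConfig → Set
    Inv ⟨ start , hs , c ⟩      = hs ≡ home × c ≡ 0
    Inv ⟨ scan j , hs , c ⟩     = hs ≡ home × 1 ≤ c × Prefix c × toℕ j ≡ nonzeros written c
    Inv ⟨ return , hs , c ⟩     = hs ≡ home × ∃[ E ] Frame E × c < E
    Inv ⟨ simulate p , hs , c ⟩ =
      ∃[ E ] Frame E × c ≤ E × ∃[ t ] run A w (truncated E) t ≡ conf p hs c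
    Inv ⟨ reject , _ , _ ⟩      = ⊤

    Preserved : MConfig → Set
    Preserved C = Inv C → ∀ x → m (MConfig.cell C) ≡ x → Inv (move w x C)

    start-inv : ∀ {hs c} → Preserved ⟨ start , hs , c ⟩
    start-inv (refl , refl) (origin a) m0≡ with tally (nz a) | tally-view (nz a)
    ... | _ | counted j j≡ =
      home-stays _ , ≤-refl , ((a , m0≡) , λ i 1≤i i<1 → ⊥-elim (<⇒≱ i<1 1≤i)) ,
      trans j≡ (sym (count-step m0≡ refl))
    ... | _ | overflow _ = tt
    start-inv _ (plain a) _ = tt
    start-inv _ end       _ = tt

    scan-inv : ∀ {j hs c} → Preserved ⟨ scan j , hs , c ⟩
    scan-inv {j} {c = c} (refl , 1≤c , (origin₀ , plains) , j≡) (plain a) mc≡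
      with tally (toℕ j + nz a) | tally-view (toℕ j + nz a)
    ... | _ | counted j′ j′≡ =
      home-stays _ , m≤n⇒m≤1+n 1≤c , (origin₀ , plains′) ,
      trans j′≡ (sym (count-step mc≡ j≡))
      where
      plains′ : ∀ i → 1 ≤ i → i < suc c → ∃[ a ] m i ≡ plain a
      plains′ i 1≤i i<1+c with m<1+n⇒m<n∨m≡n i<1+c
      ... | inj₁ i<c  = plains i 1≤i i<c
      ... | inj₂ refl = a , mc≡
    ... | _ | overflow _ = tt
    scan-inv _ (origin a) _ = tt
    scan-inv {j} {c = suc c} (refl , _ , prefix , j≡) end mc≡ =
      home-stays _ , suc c , frame , n<1+n c
      where
      frame : Frame (suc c)
      frame = record
        { prefix = prefix ; closed = mc≡ ; sparse = subst (_≤ k) j≡ (≤-pred (toℕ<n j)) }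

    return-inv : ∀ {hs c} → Preserved ⟨ return , hs , c ⟩
    return-inv (refl , E , F , c<E) (plain a) _ = home-stays _ , E , F , ≤-<-trans pred[n]≤n c<E
    return-inv {c = zero} (refl , E , F , _) (origin a) _ =
      E , F , z≤n , 0 , cong (λ hs → conf q₀ hs 0) (sym (home-stays _))
    return-inv {c = suc c} (refl , E , F , c<E) (origin a) mc≡
      with proj₂ (Frame.prefix F) (suc c) (s≤s z≤n) c<E
    ... | _ , mc≡plain with trans (sym mc≡) mc≡plain
    ...   | ()
    return-inv _ end _ = tt

    simulation-continues : ∀ {p hs c} → Inv ⟨ simulate p , hs , c ⟩ → ∀ x → x ≢ end → m c ≡ x →
                           Inv (move w x ⟨ simulate p , hs , c ⟩)
    simulation-continues {p} {hs} {c} (E , F , c≤E , t , ran) x x≢end mc≡ =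
      subst Inv (sym (simulate-commutes {truncated E} (conf p hs c) x x≢end agree))
        (E , F , ≤-trans (cell-step-≤ A w (truncated E) (conf p hs c)) c<E ,
         suc t , cong (step A w (truncated E)) ran)
      where
      c<E : c < E
      c<E = ≤∧≢⇒< c≤E (λ c≡E → x≢end (trans (sym mc≡) (trans (cong m c≡E) (Frame.closed F))))
      agree : truncated E c ≡ symbolOf x
      agree = trans (truncated-below c<E) (cong symbolOf mc≡)

    simulate-inv : ∀ {p hs c} → Preserved ⟨ simulate p , hs , c ⟩
    simulate-inv I (origin a) = simulation-continues I (origin a) (λ ())
    simulate-inv I (plain a)  = simulation-continues I (plain a) (λ ())
    simulate-inv I end        = λ _ → tt

    preserved : ∀ C → Preserved C
    preserved ⟨ start , _ , _ ⟩      = start-inv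
    preserved ⟨ scan _ , _ , _ ⟩     = scan-inv
    preserved ⟨ return , _ , _ ⟩     = return-inv
    preserved ⟨ simulate _ , _ , _ ⟩ = simulate-inv
    preserved ⟨ reject , _ , _ ⟩     = λ _ _ _ → tt

    inv-steps : ∀ t → Inv (steps w m t initial)
    inv-steps zero    = refl , refl
    inv-steps (suc t) = preserved _ (inv-steps t) _ refl

    sound-at : ∀ C → Inv C → isFinal (MConfig.state C) ≡ true → AcceptsRestr A (U k) w
    sound-at ⟨ simulate p , _ , _ ⟩ (E , F , _ , t , ran) acc =
      truncated E , frame-in-U F , t , trans (cong (accepting ∘ Config.state) ran) acc

    end-after-origin : ∀ {E a} → m 0 ≡ origin a → m E ≡ end → 1 ≤ E
    end-after-origin {zero} m0≡origin m0≡end with trans (sym m0≡origin) m0≡end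
    ... | ()
    end-after-origin {suc _} _ _ = s≤s z≤n

    check-step : ∀ {p p′ c c′ x} → m c ≡ x →
                 move w x ⟨ p , home , c ⟩ ≡ ⟨ p′ , zipWith (moveHead (length w)) stays home , c′ ⟩ →
                 Reaches w m ⟨ p , home , c ⟩ ⟨ p′ , home , c′ ⟩
    check-step {p} {p′} {c} {c′} mc≡ moved =
      reaches-step (trans (cong (λ x → move w x ⟨ p , home , c ⟩) mc≡)
                          (trans moved (cong (λ hs → ⟨ p′ , hs , c′ ⟩) (home-stays (length w)))))

    module Framed {E : ℕ} (F : Frame E) where
      open Frame F

      count-bound : ∀ c → c ≤ E → nonzeros written c ≤ k
      count-bound c c≤E = ≤-trans (nonzeros-mono written c≤E) sparse

      E≥1 : 1 ≤ E
      E≥1 = end-after-origin (proj₂ (proj₁ prefix)) closed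

      suc-pred-E : suc (pred E) ≡ E
      suc-pred-E = suc-pred E {{>-nonZero E≥1}}

      first-step : ∃[ j ] Reaches w m initial ⟨ scan j , home , 1 ⟩ × toℕ j ≡ nonzeros written 1
      first-step with proj₁ prefix
      ... | a , m0≡ with tally-≤ (nz a) (subst (_≤ k) (count-step m0≡ refl) (count-bound 1 E≥1))
      ... | j , tally≡ , j≡ =
        j , check-step m0≡ (cong (λ p → ⟨ p , _ , 1 ⟩) tally≡) , trans j≡ (sym (count-step m0≡ refl))

      scan-step : ∀ {c j} → 1 ≤ c → c < E → toℕ j ≡ nonzeros written c →
                  ∃[ j′ ] Reaches w m ⟨ scan j , home , c ⟩ ⟨ scan j′ , home , suc c ⟩
                          × toℕ j′ ≡ nonzeros written (suc c)
      scan-step {c} {j} 1≤c c<E j≡ with proj₂ prefix c 1≤c c<E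
      ... | a , mc≡
        with tally-≤ (toℕ j + nz a) (subst (_≤ k) (count-step mc≡ j≡) (count-bound (suc c) c<E))
      ... | j′ , tally≡ , j′≡ =
        j′ , check-step mc≡ (cong (λ p → ⟨ p , _ , suc c ⟩) tally≡) ,
        trans j′≡ (sym (count-step mc≡ j≡))

      scan-walk : ∀ r {c j} → r + c ≡ E → 1 ≤ c → toℕ j ≡ nonzeros written c →
                  ∃[ j′ ] Reaches w m ⟨ scan j , home , c ⟩ ⟨ scan j′ , home , E ⟩
      scan-walk zero    refl _ _ = _ , 0 , refl
      scan-walk (suc r) {c} r+c≡E 1≤c j≡ =
        let j′ , step , j′≡ = scan-step 1≤c (subst (suc c ≤_) r+1+c≡E (m≤n+m (suc c) r)) j≡
            j″ , rest       = scan-walk r r+1+c≡E (s≤s z≤n) j′≡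
        in j″ , reaches-trans step rest
        where
        r+1+c≡E : r + suc c ≡ E
        r+1+c≡E = trans (+-suc r c) r+c≡E

      return-walk : ∀ c → c < E → Reaches w m ⟨ return , home , c ⟩ ⟨ return , home , 0 ⟩
      return-walk zero    _   = 0 , refl
      return-walk (suc c) c<E with proj₂ prefix (suc c) (s≤s z≤n) c<E
      ... | a , mc≡ = reaches-trans (check-step mc≡ refl) (return-walk c (<-trans (n<1+n c) c<E))

      passes-check : Reaches w m initial ⟨ simulate q₀ , home , 0 ⟩
      passes-check =
        let j , first , j≡ = first-step
            j′ , swept      = scan-walk (pred E) (trans (+-comm (pred E) 1) suc-pred-E) ≤-refl j≡
        in reaches-trans first
          (reaches-trans swept
          (reaches-trans (check-step {p = scan j′} closed refl)
          (reaches-trans (return-walk (pred E) (subst (pred E <_) suc-pred-E ≤-refl))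
                         (check-step (proj₂ (proj₁ prefix)) refl))))

      -- the checker follows A's run on any content stored in the region, as
      -- long as A's memory cannot have left the region
      simulates : ∀ μ → Stores μ E →
                  ∀ t → t < E → Reaches w m ⟨ simulate q₀ , home , 0 ⟩ (simulated (run A w μ t))
      simulates μ agree zero    _   = 0 , refl
      simulates μ agree (suc t) t<E =
        reaches-trans (simulates μ agree t (<-trans (n<1+n t) t<E))
          (reaches-step (simulate-commutes {μ} (run A w μ t) (m c) m≢end stored))
        where
        c : ℕ
        c = Config.cell (run A w μ t)
        c<E : c < E
        c<E = ≤-<-trans (cell-run-≤ A w μ t) (<-trans (n<1+n t) t<E)
        m≢end : m c ≢ end
        m≢end = proj₁ (agree c c<E)
        stored : μ c ≡ written c
        stored = proj₂ (agree c c<E)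

      accepts-by-simulation : ∀ μ → Stores μ E →
                              ∀ t → t < E → accepting (Config.state (run A w μ t)) ≡ true →
                              MAccepts w
      accepts-by-simulation μ agree t t<E acc
        with reaches-trans passes-check (simulates μ agree t t<E)
      ... | T , reached = m , T , trans (cong (isFinal ∘ MConfig.state) reached) acc

  sound : ∀ w → MAccepts w → AcceptsRestr A (U k) w
  sound w (m , t , acc) = Guess.sound-at w m _ (Guess.inv-steps w m t) acc

  layout : (ℕ → Fin (suc d)) → ℕ → ℕ → Cell
  layout μ E zero    = origin (μ 0)
  layout μ E (suc n) with suc n <? E
  ... | yes _ = plain (μ (suc n))
  ... | no _  = end

  layout-plain : ∀ μ E c → 1 ≤ c → c < E → layout μ E c ≡ plain (μ c)
  layout-plain μ E (suc n) _ 1+n<E with suc n <? E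
  ... | yes _     = refl
  ... | no 1+n≮E  = ⊥-elim (1+n≮E 1+n<E)

  layout-end : ∀ μ E → 1 ≤ E → layout μ E E ≡ end
  layout-end μ (suc n) _ with suc n <? suc n
  ... | yes 1+n<1+n = ⊥-elim (<-irrefl refl 1+n<1+n)
  ... | no _        = refl

  layout-agrees : ∀ μ E c → c < E → layout μ E c ≢ end × μ c ≡ symbolOf (layout μ E c)
  layout-agrees μ E zero    _   = (λ ()) , refl
  layout-agrees μ E (suc n) 1+n<E
    rewrite layout-plain μ E (suc n) (s≤s z≤n) 1+n<E = (λ ()) , refl

  -- A's accepting run at time t only reads cells below t + 1, so framing
  -- μ's region [0, t + 1) lets the checker accept.
  complete : ∀ w → AcceptsRestr A (U k) w → MAccepts w
  complete w (μ , (v , covered) , t , acc) = accepts-by-simulation μ agree t ≤-refl acc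
    where
    E : ℕ
    E = suc t
    open Guess w (layout μ E)
    agree : Stores μ E
    agree = layout-agrees μ E
    sparse : nonzeros written E ≤ k
    sparse = begin
      nonzeros written E  ≡⟨ nonzeros-cong E (λ c c<E → sym (proj₂ (agree c c<E))) ⟩
      nonzeros μ E        ≤⟨ nonzeros-≤-cover μ E (toList v) (λ i _ → ∈-toList⁺ ∘ covered i) ⟩
      length (toList v)   ≡⟨ length-toList v ⟩
      k                   ∎
      where open ≤-Reasoning
    frame : Frame E
    frame = record
      { prefix = (μ 0 , refl) , (λ i 1≤i i<E → μ i , layout-plain μ E i 1≤i i<E)
      ; closed = layout-end μ E (s≤s z≤n)
      ; sparse = sparse
      }
    open Framed frame

  checker-correct : ∀ w → MAccepts w ⇔ AcceptsRestr A (U k) w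
  checker-correct w = mk⇔ (sound w) (complete w)

-- The theorem: compose the checker's correctness with its realisation as an
-- automaton.

lemma7 : (k : ℕ) → k ≥ 1 → (s : ℕ) → (L : Language s) → InRU k L → InR L
lemma7 k _ s L (d , A , L⇔A) = Finite.size finite-Cell , automaton , λ w →
  ⇔-trans (L⇔A w) (⇔-trans (⇔-sym (checker-correct w)) (⇔-sym (accepts⇔ w)))
  where
  open Checker k A
  open Realise checker finite-Phase finite-Cell
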